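{- Let $Q_n$ be the hypercube of dimension $n\ge 2$. (i) If $n\not\equiv 0\pmod 4$, then $\xi(Q_n)=2^{n-1}$. (ii) If $n\equiv 0\pmod 4$, then $2^{n-1}\le \xi(Q_n)\le 2^{n-1}+2^{\frac{n}{2}-2}$.
   Context: All graphs are finite, simple, connected and undirected; $d_G(u,v)$ is the shortest-path distance. A set $D\subseteq V(G)$ is a distance-equalizer set of $G$ if for any two vertices $x,y\in V(G)\setminus D$ there is $w\in D$ with $d_G(x,w)=d_G(y,w)$. The equidistant dimension $\xi(G)$ is the minimum cardinality of a distance-equalizer set of $G$. The hypercube $Q_n$ has vertex set $\{0,1\}^n$, two vertices being adjacent iff they differ in exactly one coordinate. -}

module Defs where

open import Data.Nat using (ℕ; zero; suc; _+_; _*_; _≤_; _<_)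
open import Data.Empty using (⊥)
open import Data.Bool using (Bool; true; false)
open import Data.Vec using (Vec; []; _∷_)
open import Data.List using (List; length)
open import Data.List.Membership.Propositional using (_∈_; _∉_)
open import Data.List.Relation.Unary.Unique.Propositional using (Unique)
open import Data.Product using (Σ; ∃; _×_; _,_)
open import Relation.Binary.PropositionalEquality using (_≡_)

record Graph : Set₁ where
  field
    V   : Set
    Adj : V → V → Set

open Graph public

data Walk (G : Graph) : V G → V G → ℕ → Set where
  here : ∀ {x} → Walk G x x zero
  step : ∀ {x y z k} → Adj G x y → Walk G y z k → Walk G x z (suc k)

Dist : (G : Graph) → V G → V G → ℕ → Set
Dist G x y k = Walk G x y k × (∀ {m} → Walk G x y m → k ≤ m)

Equidistant : (G : Graph) → V G → V G → V G → Set
Equidistant G x y w = ∃ λ k → Dist G x w k × Dist G y w k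

IsDistanceEqualizer : (G : Graph) → List (V G) → Set
IsDistanceEqualizer G D =
  ∀ x y → x ∉ D → y ∉ D → ∃ λ w → w ∈ D × Equidistant G x y w

EquidistantDimension : (G : Graph) → ℕ → Set
EquidistantDimension G k =
  (∃ λ D → Unique D × IsDistanceEqualizer G D × length D ≡ k)
  × (∀ D → Unique D → IsDistanceEqualizer G D → k ≤ length D)

data DiffOne : ∀ {n} → Vec Bool n → Vec Bool n → Set where
  head-diff : ∀ {n} {a b : Bool} {xs : Vec Bool n} →
              (a ≡ b → ⊥) → DiffOne (a ∷ xs) (b ∷ xs)
  tail-diff : ∀ {n} {a : Bool} {xs ys : Vec Bool n} →
              DiffOne xs ys → DiffOne (a ∷ xs) (a ∷ ys)

Q : ℕ → Graph
Q n = record { V = Vec Bool n ; Adj = DiffOne }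

-- Distances in Q n are Hamming distances and Q n is bipartite, so a vertex equidistant from x
-- and y forces x and y to have the same parity. Hence the vertices outside a distance-equalizer
-- set share one parity and the set contains the whole other parity class, of size 2^(n-1).
-- Conversely, that class equalizes every pair x, y of the first parity. If d(x,y) = 2k < n, go k
-- steps from each towards the other along a geodesic and use a coordinate where x and y agree to
-- fix the parity of the meeting point. If x and y are antipodal (2k = n), their midpoints have
-- the parity of x shifted by k, which is the opposite one exactly when n ≢ 0 (mod 4).
-- For n = 4m + 4 split the coordinates into blocks of sizes 2m + 3 and 2m + 1 and add the 2^(2m)
-- vertices 0 ++ u with u even. Even antipodal x = xa ++ xb, y = ya ++ yb outside this set have
-- first blocks of weights r + 1 and t + 1 with r + t = 2m + 1; a point u at distances t from xb
-- and r from yb makes 0 ++ u equidistant from x and y, and u is even because 2m + 2 is.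

module Submission where

open import Defs
open import Data.Bool using (Bool; true; false) renaming (_≟_ to _≟ᵇ_)
open import Data.Nat using (ℕ; zero; suc; _+_; _*_; _∸_; _^_; _≤_; _<_; _%_; _/_; z≤n; s≤s; parity)
open import Data.Nat.Properties
  using ( module ≤-Reasoning; ≤-refl; ≤-trans; ≤-antisym; ≤-reflexive; <-irrefl; m≤n⇒m<n∨m≡n
        ; +-monoˡ-≤; +-monoʳ-≤; m≤n+m; +-cancelʳ-≤; +-suc; +-comm; +-assoc; +-identityʳ; +-cancelˡ-≡
        ; suc-injective)
open import Data.Nat.DivMod using (m*n%n≡0; m*n/n≡m; m≡m%n+[m/n]*n)
open import Data.Nat.Tactic.RingSolver using (solve-∀)
open import Data.Parity using (Parity; 0ℙ; 1ℙ; _⁻¹) renaming (_+_ to _⊕_)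
import Data.Parity.Properties as ℙ
open import Data.Parity.Properties
  using (⁻¹-involutive; p≢p⁻¹; p+p≡0ℙ; +-homo-+; +-commutativeSemigroup)
open import Algebra.Properties.CommutativeSemigroup +-commutativeSemigroup using (interchange)
open import Data.Vec using (Vec; []; _∷_; replicate; splitAt) renaming (_++_ to _++ᵛ_)
open import Data.Vec.Properties using (∷-injectiveʳ; ++-injectiveʳ; ≡-dec)
open import Data.List using (List; []; _∷_; [_]; map; _++_; length)
open import Data.List.Properties using (length-++; length-map; length-++-sucʳ)
open import Data.List.Membership.Propositional using (_∈_; _∉_)
open import Data.List.Membership.Propositional.Properties
  using (∈-map⁺; ∈-map⁻; ∈-++⁺ˡ; ∈-++⁺ʳ; ∈-++⁻; ∈-∃++)
import Data.List.Membership.DecPropositional as DecMembership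
open import Data.List.Relation.Unary.Any using (here; there; satisfied)
import Data.List.Relation.Unary.All as All
open import Data.List.Relation.Unary.All using ([]; all?)
open import Data.List.Relation.Unary.All.Properties using (¬All⇒Any¬)
open import Data.List.Relation.Unary.AllPairs using ([]; _∷_)
open import Data.List.Relation.Unary.Unique.Propositional using (Unique)
open import Data.List.Relation.Unary.Unique.Propositional.Properties using (map⁺; ++⁺)
open import Data.List.Relation.Binary.Disjoint.Propositional using (Disjoint)
open import Data.List.Relation.Binary.Subset.Propositional using (_⊆_)
open import Data.Product using (∃; ∃₂; _×_; _,_; proj₁; proj₂)
open import Data.Sum using (_⊎_; inj₁; inj₂)
open import Function.Base using (_∘_; _⟨_⟩_)
open import Relation.Nullary using (Dec; yes; no; contradiction)
open import Relation.Binary.PropositionalEquality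
  using (_≡_; _≢_; refl; sym; trans; cong; cong₂; subst; module ≡-Reasoning)

bitDistance : Bool → Bool → ℕ
bitDistance false false = 0
bitDistance true  true  = 0
bitDistance false true  = 1
bitDistance true  false = 1

hamming : ∀ {n} → Vec Bool n → Vec Bool n → ℕ
hamming []      []      = 0
hamming (a ∷ x) (b ∷ y) = bitDistance a b + hamming x y

bitDistance≤1 : ∀ a b → bitDistance a b ≤ 1
bitDistance≤1 false false = z≤n
bitDistance≤1 true  true  = z≤n
bitDistance≤1 false true  = ≤-refl
bitDistance≤1 true  false = ≤-refl

hamming-self : ∀ {n} (x : Vec Bool n) → hamming x x ≡ 0
hamming-self []        = refl
hamming-self (false ∷ x) = hamming-self x
hamming-self (true  ∷ x) = hamming-self x

hamming-≤ : ∀ {n} (x y : Vec Bool n) → hamming x y ≤ n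
hamming-≤ []      []      = z≤n
hamming-≤ (a ∷ x) (b ∷ y) = +-monoˡ-≤ (hamming x y) (bitDistance≤1 a b) ⟨ ≤-trans ⟩ s≤s (hamming-≤ x y)

hamming-adjacent : ∀ {n} {x y : Vec Bool n} → DiffOne x y → ∀ z → hamming x z ≤ suc (hamming y z)
hamming-adjacent (head-diff {a = a} {b} {xs} _) (c ∷ z) =
  +-monoˡ-≤ (hamming xs z) (bitDistance≤1 a c) ⟨ ≤-trans ⟩ s≤s (m≤n+m (hamming xs z) (bitDistance b c))
hamming-adjacent (tail-diff {a = a} x~y) (c ∷ z) =
  +-monoʳ-≤ (bitDistance a c) (hamming-adjacent x~y z) ⟨ ≤-trans ⟩ ≤-reflexive (+-suc (bitDistance a c) _)

hamming-≤-walk : ∀ {n} {x y : Vec Bool n} {k} → Walk (Q n) x y k → hamming x y ≤ k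
hamming-≤-walk {x = x} here       = ≤-reflexive (hamming-self x)
hamming-≤-walk {y = y} (step x~z w) = hamming-adjacent x~z y ⟨ ≤-trans ⟩ s≤s (hamming-≤-walk w)

walk-∷ : ∀ {n} (c : Bool) {x y : Vec Bool n} {k} → Walk (Q n) x y k → Walk (Q (suc n)) (c ∷ x) (c ∷ y) k
walk-∷ c here         = here
walk-∷ c (step x~z w) = step (tail-diff x~z) (walk-∷ c w)

hamming-walk : ∀ {n} (x y : Vec Bool n) → Walk (Q n) x y (hamming x y)
hamming-walk []          []          = here
hamming-walk (false ∷ x) (false ∷ y) = walk-∷ false (hamming-walk x y)
hamming-walk (true  ∷ x) (true  ∷ y) = walk-∷ true (hamming-walk x y)
hamming-walk (false ∷ x) (true  ∷ y) = step (head-diff λ ()) (walk-∷ true (hamming-walk x y))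
hamming-walk (true  ∷ x) (false ∷ y) = step (head-diff λ ()) (walk-∷ false (hamming-walk x y))

hamming-Dist : ∀ {n} (x y : Vec Bool n) → Dist (Q n) x y (hamming x y)
hamming-Dist x y = hamming-walk x y , hamming-≤-walk

Dist⇒≡hamming : ∀ {n} {x y : Vec Bool n} {k} → Dist (Q n) x y k → k ≡ hamming x y
Dist⇒≡hamming {x = x} {y} (walk , minimal) = ≤-antisym (minimal (hamming-walk x y)) (hamming-≤-walk walk)

Equidistant⇒hamming≡ : ∀ {n} {x y w : Vec Bool n} → Equidistant (Q n) x y w → hamming x w ≡ hamming y w
Equidistant⇒hamming≡ (_ , dxw , dyw) = trans (sym (Dist⇒≡hamming dxw)) (Dist⇒≡hamming dyw)

hamming≡⇒Equidistant : ∀ {n} {x y w : Vec Bool n} → hamming x w ≡ hamming y w → Equidistant (Q n) x y w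
hamming≡⇒Equidistant {x = x} {y} {w} eq =
  hamming x w , hamming-Dist x w , subst (Dist (Q _) y w) (sym eq) (hamming-Dist y w)

bitParity : Bool → Parity
bitParity false = 0ℙ
bitParity true  = 1ℙ

vertexParity : ∀ {n} → Vec Bool n → Parity
vertexParity []      = 0ℙ
vertexParity (b ∷ v) = bitParity b ⊕ vertexParity v

parity-bitDistance : ∀ a b → parity (bitDistance a b) ≡ bitParity a ⊕ bitParity b
parity-bitDistance false false = refl
parity-bitDistance true  true  = refl
parity-bitDistance false true  = refl
parity-bitDistance true  false = refl

parity-hamming : ∀ {n} (x y : Vec Bool n) → parity (hamming x y) ≡ vertexParity x ⊕ vertexParity y
parity-hamming []      []      = refl
parity-hamming (a ∷ x) (b ∷ y) = begin
  parity (bitDistance a b + hamming x y)               ≡⟨ +-homo-+ (bitDistance a b) (hamming x y) ⟩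
  parity (bitDistance a b) ⊕ parity (hamming x y)
                                  ≡⟨ cong₂ _⊕_ (parity-bitDistance a b) (parity-hamming x y) ⟩
  (bitParity a ⊕ bitParity b) ⊕ (vertexParity x ⊕ vertexParity y)
                                                       ≡⟨ interchange (bitParity a) (bitParity b) _ _ ⟩
  (bitParity a ⊕ vertexParity x) ⊕ (bitParity b ⊕ vertexParity y) ∎
  where open ≡-Reasoning

vertexParity-hamming : ∀ {n} (x y : Vec Bool n) → vertexParity y ≡ vertexParity x ⊕ parity (hamming x y)
vertexParity-hamming x y = sym (begin
  vertexParity x ⊕ parity (hamming x y)                 ≡⟨ cong (vertexParity x ⊕_) (parity-hamming x y) ⟩
  vertexParity x ⊕ (vertexParity x ⊕ vertexParity y)    ≡⟨ sym (ℙ.+-assoc (vertexParity x) _ _) ⟩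
  (vertexParity x ⊕ vertexParity x) ⊕ vertexParity y    ≡⟨ cong (_⊕ vertexParity y) (p+p≡0ℙ (vertexParity x)) ⟩
  vertexParity y                                        ∎)
  where open ≡-Reasoning

equidistant⇒sameParity : ∀ {n} (x y w : Vec Bool n) → hamming x w ≡ hamming y w → vertexParity x ≡ vertexParity y
equidistant⇒sameParity x y w eq = ℙ.+-cancelʳ-≡ (vertexParity w) _ _
  (trans (sym (parity-hamming x w)) (trans (cong parity eq) (parity-hamming y w)))

even⇒double : ∀ m → parity m ≡ 0ℙ → ∃ λ k → k + k ≡ m
even⇒double zero          _    = 0 , refl
even⇒double (suc zero)    ()
even⇒double (suc (suc m)) even with k , k+k≡m ← even⇒double m even =
  suc k , cong suc (trans (+-suc k k) (cong suc k+k≡m))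

parityClass : (n : ℕ) → Parity → List (Vec Bool n)
parityClass zero    0ℙ = [ [] ]
parityClass zero    1ℙ = []
parityClass (suc n) p  = map (false ∷_) (parityClass n p) ++ map (true ∷_) (parityClass n (p ⁻¹))

∈-parityClass⁺ : ∀ {n p} (v : Vec Bool n) → vertexParity v ≡ p → v ∈ parityClass n p
∈-parityClass⁺ []          refl = here refl
∈-parityClass⁺ (false ∷ v) refl = ∈-++⁺ˡ (∈-map⁺ (false ∷_) (∈-parityClass⁺ v refl))
∈-parityClass⁺ {suc n} (true ∷ v) refl =
  ∈-++⁺ʳ (map (false ∷_) (parityClass n _)) (∈-map⁺ (true ∷_) (∈-parityClass⁺ v (sym (⁻¹-involutive _))))

∈-parityClass⁻ : ∀ {n p} {v : Vec Bool n} → v ∈ parityClass n p → vertexParity v ≡ p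
∈-parityClass⁻ {zero} {0ℙ} {[]} _ = refl
∈-parityClass⁻ {suc n} {p} v∈ with ∈-++⁻ (map (false ∷_) (parityClass n p)) v∈
... | inj₁ v∈₀ with _ , u∈ , refl ← ∈-map⁻ (false ∷_) v∈₀ = ∈-parityClass⁻ u∈
... | inj₂ v∈₁ with _ , u∈ , refl ← ∈-map⁻ (true ∷_) v∈₁ =
  trans (cong _⁻¹ (∈-parityClass⁻ u∈)) (⁻¹-involutive p)

parity-dichotomy : ∀ p q → q ≡ p ⊎ q ≡ p ⁻¹
parity-dichotomy 0ℙ 0ℙ = inj₁ refl
parity-dichotomy 1ℙ 1ℙ = inj₁ refl
parity-dichotomy 0ℙ 1ℙ = inj₂ refl
parity-dichotomy 1ℙ 0ℙ = inj₂ refl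

∉-parityClass : ∀ {n p} (v : Vec Bool n) → v ∉ parityClass n p → vertexParity v ≡ p ⁻¹
∉-parityClass {p = p} v v∉ with parity-dichotomy p (vertexParity v)
... | inj₁ v≡p   = contradiction (∈-parityClass⁺ v v≡p) v∉
... | inj₂ v≡p⁻¹ = v≡p⁻¹

length-parityClass : ∀ n p → length (parityClass (suc n) p) ≡ 2 ^ n
length-parityClass zero    0ℙ = refl
length-parityClass zero    1ℙ = refl
length-parityClass (suc n) p  = begin
  length (map (false ∷_) (parityClass (suc n) p) ++ map (true ∷_) (parityClass (suc n) (p ⁻¹)))
    ≡⟨ length-++ (map (false ∷_) (parityClass (suc n) p)) ⟩
  length (map (false ∷_) (parityClass (suc n) p)) + length (map (true ∷_) (parityClass (suc n) (p ⁻¹)))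
    ≡⟨ cong₂ _+_ (length-map (false ∷_) (parityClass (suc n) p))
                 (length-map (true ∷_) (parityClass (suc n) (p ⁻¹))) ⟩
  length (parityClass (suc n) p) + length (parityClass (suc n) (p ⁻¹))
    ≡⟨ cong₂ _+_ (length-parityClass n p) (length-parityClass n (p ⁻¹)) ⟩
  2 ^ n + 2 ^ n
    ≡⟨ cong (2 ^ n +_) (sym (+-identityʳ (2 ^ n))) ⟩
  2 ^ suc n ∎
  where open ≡-Reasoning

head-disjoint : ∀ {n} (xs ys : List (Vec Bool n)) → Disjoint (map (false ∷_) xs) (map (true ∷_) ys)
head-disjoint xs ys (v∈₀ , v∈₁)
  with _ , _ , refl ← ∈-map⁻ (false ∷_) v∈₀ | _ , _ , () ← ∈-map⁻ (true ∷_) v∈₁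

parityClass-unique : ∀ n p → Unique (parityClass n p)
parityClass-unique zero    0ℙ = [] ∷ []
parityClass-unique zero    1ℙ = []
parityClass-unique (suc n) p  =
  ++⁺ (map⁺ ∷-injectiveʳ (parityClass-unique n p)) (map⁺ ∷-injectiveʳ (parityClass-unique n (p ⁻¹)))
      (head-disjoint (parityClass n p) (parityClass n (p ⁻¹)))

∈-++-∷⁻ : ∀ {A : Set} {x z : A} (ys₁ ys₂ : List A) → z ∈ ys₁ ++ x ∷ ys₂ → z ≢ x → z ∈ ys₁ ++ ys₂
∈-++-∷⁻ ys₁ ys₂ z∈ z≢x with ∈-++⁻ ys₁ z∈
... | inj₁ z∈ys₁         = ∈-++⁺ˡ z∈ys₁
... | inj₂ (here z≡x)    = contradiction z≡x z≢x
... | inj₂ (there z∈ys₂) = ∈-++⁺ʳ ys₁ z∈ys₂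

length-mono-⊆ : ∀ {A : Set} {xs ys : List A} → Unique xs → xs ⊆ ys → length xs ≤ length ys
length-mono-⊆ {xs = []}     _                   _      = z≤n
length-mono-⊆ {xs = x ∷ xs} (x≢xs ∷ xs-unique) x∷xs⊆ys
  with ys₁ , ys₂ , refl ← ∈-∃++ (x∷xs⊆ys (here refl)) = begin
    suc (length xs)            ≤⟨ s≤s (length-mono-⊆ xs-unique xs⊆ys₁ys₂) ⟩
    suc (length (ys₁ ++ ys₂))  ≡⟨ length-++-sucʳ ys₁ x ys₂ ⟨
    length (ys₁ ++ x ∷ ys₂)    ∎
  where
  open ≤-Reasoning
  xs⊆ys₁ys₂ : xs ⊆ ys₁ ++ ys₂
  xs⊆ys₁ys₂ z∈xs = ∈-++-∷⁻ ys₁ ys₂ (x∷xs⊆ys (there z∈xs)) (λ z≡x → All.lookup x≢xs z∈xs (sym z≡x))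

_∈?_ : ∀ {n} (v : Vec Bool n) (D : List (Vec Bool n)) → Dec (v ∈ D)
v ∈? D = DecMembership._∈?_ (≡-dec _≟ᵇ_) v D

complementClass-⊆ : ∀ {n D} {x : Vec Bool n} →
  IsDistanceEqualizer (Q n) D → x ∉ D → parityClass n (vertexParity x ⁻¹) ⊆ D
complementClass-⊆ {D = D} {x} equalizer x∉D {y} y∈class with y ∈? D
... | yes y∈D = y∈D
... | no  y∉D with w , _ , x≐y ← equalizer x y x∉D y∉D =
  contradiction (trans (equidistant⇒sameParity x y w (Equidistant⇒hamming≡ x≐y)) (∈-parityClass⁻ y∈class))
                (p≢p⁻¹ (vertexParity x))

parityClass-⊆-equalizer : ∀ n {D} → IsDistanceEqualizer (Q n) D → ∃ λ p → parityClass n p ⊆ D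
parityClass-⊆-equalizer n {D} equalizer with all? (_∈? D) (parityClass n 0ℙ)
... | yes evens∈D = 0ℙ , All.lookup evens∈D
... | no  evens∉D with x , x∉D ← satisfied (¬All⇒Any¬ (_∈? D) (parityClass n 0ℙ) evens∉D) =
  vertexParity x ⁻¹ , complementClass-⊆ equalizer x∉D

equalizer-lowerBound : ∀ n D → IsDistanceEqualizer (Q (suc n)) D → 2 ^ n ≤ length D
equalizer-lowerBound n D equalizer with p , class⊆D ← parityClass-⊆-equalizer (suc n) equalizer =
  subst (_≤ length D) (length-parityClass n p) (length-mono-⊆ (parityClass-unique (suc n) p) class⊆D)

between : ∀ {n} (x y : Vec Bool n) a b → a + b ≡ hamming x y → ∃ λ w → hamming x w ≡ a × hamming y w ≡ b
between []          []          zero    zero    _  = [] , refl , refl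
between (false ∷ x) (false ∷ y) a       b       eq with w , xw , yw ← between x y a b eq = false ∷ w , xw , yw
between (true  ∷ x) (true  ∷ y) a       b       eq with w , xw , yw ← between x y a b eq = true ∷ w , xw , yw
between (true  ∷ x) (false ∷ y) (suc a) b       eq with w , xw , yw ← between x y a b (suc-injective eq) =
  false ∷ w , cong suc xw , yw
between (true  ∷ x) (false ∷ y) zero    (suc b) eq with w , xw , yw ← between x y zero b (suc-injective eq) =
  true ∷ w , xw , cong suc yw
between (false ∷ x) (true  ∷ y) (suc a) b       eq with w , xw , yw ← between x y a b (suc-injective eq) =
  true ∷ w , cong suc xw , yw
between (false ∷ x) (true  ∷ y) zero    (suc b) eq with w , xw , yw ← between x y zero b (suc-injective eq) =
  false ∷ w , xw , cong suc yw
between (true  ∷ x) (false ∷ y) zero    zero    ()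
between (false ∷ x) (true  ∷ y) zero    zero    ()

bitOf : Parity → Bool
bitOf 0ℙ = false
bitOf 1ℙ = true

bitParity-bitOf : ∀ q → bitParity (bitOf q) ≡ q
bitParity-bitOf 0ℙ = refl
bitParity-bitOf 1ℙ = refl

vertexParity-adjusted : ∀ {n} p (w : Vec Bool n) → vertexParity (bitOf (p ⊕ vertexParity w) ∷ w) ≡ p
vertexParity-adjusted p w = begin
  bitParity (bitOf (p ⊕ vertexParity w)) ⊕ vertexParity w
                                     ≡⟨ cong (_⊕ vertexParity w) (bitParity-bitOf (p ⊕ vertexParity w)) ⟩
  (p ⊕ vertexParity w) ⊕ vertexParity w                    ≡⟨ ℙ.+-assoc p _ _ ⟩
  p ⊕ (vertexParity w ⊕ vertexParity w)                    ≡⟨ cong (p ⊕_) (p+p≡0ℙ (vertexParity w)) ⟩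
  p ⊕ 0ℙ                                                   ≡⟨ ℙ.+-identityʳ p ⟩
  p                                                        ∎
  where open ≡-Reasoning

-- The agreeing first coordinate is free, so it is chosen to give w the required parity.
between-∷-ofParity : ∀ {n} c (x y : Vec Bool n) a b → a + b ≡ hamming x y → ∀ p →
  ∃₂ λ w d → hamming (c ∷ x) w ≡ a + d × hamming (c ∷ y) w ≡ b + d × vertexParity w ≡ p
between-∷-ofParity c x y a b eq p =
  let w , xw , yw = between x y a b eq
      bit = bitOf (p ⊕ vertexParity w)
      d = bitDistance c bit
  in  bit ∷ w , d , trans (cong (d +_) xw) (+-comm d a) , trans (cong (d +_) yw) (+-comm d b)
    , vertexParity-adjusted p w

between-ofParity : ∀ {n} (x y : Vec Bool n) a b → a + b ≡ hamming x y → hamming x y < n → ∀ p →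
  ∃₂ λ w c → hamming x w ≡ a + c × hamming y w ≡ b + c × vertexParity w ≡ p
between-ofParity (false ∷ x) (false ∷ y) a b eq _ p = between-∷-ofParity false x y a b eq p
between-ofParity (true  ∷ x) (true  ∷ y) a b eq _ p = between-∷-ofParity true x y a b eq p
between-ofParity (true ∷ x) (false ∷ y) (suc a) b eq (s≤s non-antipodal) p
  with w , c , xw , yw , wp ← between-ofParity x y a b (suc-injective eq) non-antipodal p =
  false ∷ w , c , cong suc xw , yw , wp
between-ofParity (true ∷ x) (false ∷ y) zero (suc b) eq (s≤s non-antipodal) p
  with w , c , xw , yw , wp ← between-ofParity x y zero b (suc-injective eq) non-antipodal (p ⁻¹) =
  true ∷ w , c , xw , cong suc yw , trans (cong _⁻¹ wp) (⁻¹-involutive p)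
between-ofParity (false ∷ x) (true ∷ y) (suc a) b eq (s≤s non-antipodal) p
  with w , c , xw , yw , wp ← between-ofParity x y a b (suc-injective eq) non-antipodal (p ⁻¹) =
  true ∷ w , c , cong suc xw , yw , trans (cong _⁻¹ wp) (⁻¹-involutive p)
between-ofParity (false ∷ x) (true ∷ y) zero (suc b) eq (s≤s non-antipodal) p
  with w , c , xw , yw , wp ← between-ofParity x y zero b (suc-injective eq) non-antipodal p =
  false ∷ w , c , xw , cong suc yw , wp
between-ofParity (true  ∷ x) (false ∷ y) zero zero () _ _
between-ofParity (false ∷ x) (true  ∷ y) zero zero () _ _

sameParity⇒hamming-double : ∀ {n} (x y : Vec Bool n) → vertexParity x ≡ vertexParity y →
  ∃ λ k → k + k ≡ hamming x y
sameParity⇒hamming-double x y x∼y = even⇒double (hamming x y)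
  (trans (parity-hamming x y) (trans (cong (_⊕ vertexParity y) x∼y) (p+p≡0ℙ (vertexParity y))))

sameParity⇒equalized : ∀ {n} (x y : Vec Bool n) → vertexParity x ≡ vertexParity y → hamming x y < n →
  ∀ p → ∃ λ w → vertexParity w ≡ p × hamming x w ≡ hamming y w
sameParity⇒equalized x y x∼y non-antipodal p
  with k , k+k≡d ← sameParity⇒hamming-double x y x∼y
  with w , _ , xw , yw , wp ← between-ofParity x y k k k+k≡d non-antipodal p =
  w , wp , trans xw (sym yw)

double-double : ∀ j → (j + j) + (j + j) ≡ j * 4
double-double = solve-∀

half-odd : ∀ {k n} → k + k ≡ n → n % 4 ≢ 0 → parity k ≡ 1ℙ
half-odd {k} k+k≡n n≢0 with parity-dichotomy 1ℙ (parity k)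
... | inj₁ k-odd  = k-odd
... | inj₂ k-even with j , j+j≡k ← even⇒double k k-even =
  contradiction (subst (λ m → m % 4 ≡ 0) j*4≡n (m*n%n≡0 j 4)) n≢0
  where
  j*4≡n : j * 4 ≡ _
  j*4≡n = trans (sym (double-double j)) (trans (cong₂ _+_ j+j≡k j+j≡k) k+k≡n)

antipodal-midpoint-of-oppositeParity : ∀ {n} (x y : Vec Bool n) → n % 4 ≢ 0 → vertexParity x ≡ vertexParity y →
  hamming x y ≡ n → ∃ λ w → vertexParity w ≡ vertexParity x ⁻¹ × hamming x w ≡ hamming y w
antipodal-midpoint-of-oppositeParity x y n≢0 x∼y antipodal
  with k , k+k≡d ← sameParity⇒hamming-double x y x∼y
  with w , xw , yw ← between x y k k k+k≡d = w , w-parity , trans xw (sym yw)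
  where
  open ≡-Reasoning
  w-parity : vertexParity w ≡ vertexParity x ⁻¹
  w-parity = begin
    vertexParity w                         ≡⟨ vertexParity-hamming x w ⟩
    vertexParity x ⊕ parity (hamming x w)  ≡⟨ cong (λ d → vertexParity x ⊕ parity d) xw ⟩
    vertexParity x ⊕ parity k              ≡⟨ cong (vertexParity x ⊕_) (half-odd {k} (trans k+k≡d antipodal) n≢0) ⟩
    vertexParity x ⊕ 1ℙ                    ≡⟨ ℙ.+-comm (vertexParity x) 1ℙ ⟩
    vertexParity x ⁻¹                      ∎

equalizer-from-antipodal : ∀ {n} p (D : List (Vec Bool n)) → parityClass n p ⊆ D →
  (∀ x y → x ∉ D → y ∉ D → vertexParity x ≡ p ⁻¹ → vertexParity y ≡ p ⁻¹ → hamming x y ≡ n →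
     ∃ λ w → w ∈ D × hamming x w ≡ hamming y w) →
  IsDistanceEqualizer (Q n) D
equalizer-from-antipodal {n} p D class⊆D antipodal x y x∉D y∉D = equalize (m≤n⇒m<n∨m≡n (hamming-≤ x y))
  where
  x-parity : vertexParity x ≡ p ⁻¹
  x-parity = ∉-parityClass x (λ x∈ → x∉D (class⊆D x∈))
  y-parity : vertexParity y ≡ p ⁻¹
  y-parity = ∉-parityClass y (λ y∈ → y∉D (class⊆D y∈))
  equalize : hamming x y < n ⊎ hamming x y ≡ n → ∃ λ w → w ∈ D × Equidistant (Q n) x y w
  equalize (inj₁ non-antipodal) =
    let w , wp , xw≡yw = sameParity⇒equalized x y (trans x-parity (sym y-parity)) non-antipodal p
    in  w , class⊆D (∈-parityClass⁺ w wp) , hamming≡⇒Equidistant xw≡yw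
  equalize (inj₂ x-y-antipodal) =
    let w , w∈D , xw≡yw = antipodal x y x∉D y∉D x-parity y-parity x-y-antipodal
    in  w , w∈D , hamming≡⇒Equidistant xw≡yw

parityClass-equalizer : ∀ n p → n % 4 ≢ 0 → IsDistanceEqualizer (Q n) (parityClass n p)
parityClass-equalizer n p n≢0 =
  equalizer-from-antipodal p (parityClass n p) (λ v∈ → v∈) λ x y _ _ xp yp antipodal →
  let w , wp , xw≡yw = antipodal-midpoint-of-oppositeParity x y n≢0 (trans xp (sym yp)) antipodal
  in  w , ∈-parityClass⁺ w (trans wp (trans (cong _⁻¹ xp) (⁻¹-involutive p))) , xw≡yw

hamming-++ : ∀ {m n} (xa ya : Vec Bool m) (xb yb : Vec Bool n) →
  hamming (xa ++ᵛ xb) (ya ++ᵛ yb) ≡ hamming xa ya + hamming xb yb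
hamming-++ []       []       xb yb = refl
hamming-++ (a ∷ xa) (b ∷ ya) xb yb =
  trans (cong (bitDistance a b +_) (hamming-++ xa ya xb yb)) (sym (+-assoc (bitDistance a b) _ _))

vertexParity-++ : ∀ {m n} (xa : Vec Bool m) (xb : Vec Bool n) →
  vertexParity (xa ++ᵛ xb) ≡ vertexParity xa ⊕ vertexParity xb
vertexParity-++ []       xb = refl
vertexParity-++ (a ∷ xa) xb =
  trans (cong (bitParity a ⊕_) (vertexParity-++ xa xb)) (sym (ℙ.+-assoc (bitParity a) _ _))

vertexParity-zeros : ∀ n → vertexParity (replicate n false) ≡ 0ℙ
vertexParity-zeros zero    = refl
vertexParity-zeros (suc n) = vertexParity-zeros n

vertexParity-++-even : ∀ {m n} (xa : Vec Bool m) (xb : Vec Bool n) →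
  vertexParity (xa ++ᵛ xb) ≡ 0ℙ → vertexParity xa ≡ vertexParity xb
vertexParity-++-even xa xb even = ℙ.+-cancelʳ-≡ (vertexParity xb) _ _ (begin
  vertexParity xa ⊕ vertexParity xb  ≡⟨ vertexParity-++ xa xb ⟨
  vertexParity (xa ++ᵛ xb)           ≡⟨ even ⟩
  0ℙ                                 ≡⟨ p+p≡0ℙ (vertexParity xb) ⟨
  vertexParity xb ⊕ vertexParity xb  ∎)
  where open ≡-Reasoning

vertexParity≡parity-weight : ∀ {n} (x : Vec Bool n) → vertexParity x ≡ parity (hamming x (replicate n false))
vertexParity≡parity-weight {n} x = begin
  vertexParity x                                   ≡⟨ ℙ.+-identityʳ (vertexParity x) ⟨
  vertexParity x ⊕ 0ℙ                              ≡⟨ cong (vertexParity x ⊕_) (vertexParity-zeros n) ⟨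
  vertexParity x ⊕ vertexParity (replicate n false) ≡⟨ parity-hamming x (replicate n false) ⟨
  parity (hamming x (replicate n false))           ∎
  where open ≡-Reasoning

hamming≡0⇒≡ : ∀ {n} (x y : Vec Bool n) → hamming x y ≡ 0 → x ≡ y
hamming≡0⇒≡ []          []          _  = refl
hamming≡0⇒≡ (false ∷ x) (false ∷ y) eq = cong (false ∷_) (hamming≡0⇒≡ x y eq)
hamming≡0⇒≡ (true  ∷ x) (true  ∷ y) eq = cong (true ∷_) (hamming≡0⇒≡ x y eq)

hamming-antipodal : ∀ {n} (x y : Vec Bool n) → hamming x y ≡ n → ∀ z → hamming x z + hamming y z ≡ n
hamming-antipodal []          []          _  []          = refl
hamming-antipodal (true  ∷ x) (false ∷ y) eq (false ∷ z) = cong suc (hamming-antipodal x y (suc-injective eq) z)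
hamming-antipodal (false ∷ x) (true  ∷ y) eq (true  ∷ z) = cong suc (hamming-antipodal x y (suc-injective eq) z)
hamming-antipodal (true  ∷ x) (false ∷ y) eq (true  ∷ z) =
  trans (+-suc (hamming x z) _) (cong suc (hamming-antipodal x y (suc-injective eq) z))
hamming-antipodal (false ∷ x) (true  ∷ y) eq (false ∷ z) =
  trans (+-suc (hamming x z) _) (cong suc (hamming-antipodal x y (suc-injective eq) z))
hamming-antipodal {suc n} (false ∷ x) (false ∷ y) eq _ = contradiction (subst (_≤ n) eq (hamming-≤ x y)) (<-irrefl refl)
hamming-antipodal {suc n} (true  ∷ x) (true  ∷ y) eq _ = contradiction (subst (_≤ n) eq (hamming-≤ x y)) (<-irrefl refl)

bounded-sum-≡ : ∀ {a b c d} → a ≤ c → b ≤ d → a + b ≡ c + d → a ≡ c × b ≡ d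
bounded-sum-≡ {a} {b} {c} {d} a≤c b≤d eq = a≡c , +-cancelˡ-≡ a b d (trans eq (cong (_+ d) (sym a≡c)))
  where
  a≡c : a ≡ c
  a≡c = ≤-antisym a≤c (+-cancelʳ-≤ d c a (subst (_≤ a + d) eq (+-monoʳ-≤ a b≤d)))

hamming-++-antipodal : ∀ {m n} (xa ya : Vec Bool m) (xb yb : Vec Bool n) →
  hamming (xa ++ᵛ xb) (ya ++ᵛ yb) ≡ m + n → hamming xa ya ≡ m × hamming xb yb ≡ n
hamming-++-antipodal xa ya xb yb antipodal =
  bounded-sum-≡ (hamming-≤ xa ya) (hamming-≤ xb yb) (trans (sym (hamming-++ xa ya xb yb)) antipodal)

module MultipleOfFour (m : ℕ) where

  B : ℕ
  B = suc (m + m)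

  A : ℕ
  A = suc (suc B)

  N : ℕ
  N = A + B

  zeros : Vec Bool A
  zeros = replicate A false

  E : List (Vec Bool N)
  E = map (zeros ++ᵛ_) (parityClass B 0ℙ)

  D : List (Vec Bool N)
  D = parityClass N 1ℙ ++ E

  ∈E⁻ : ∀ {v} → v ∈ E → vertexParity v ≡ 0ℙ
  ∈E⁻ v∈E with u , u∈ , refl ← ∈-map⁻ (zeros ++ᵛ_) v∈E =
    trans (vertexParity-++ zeros u) (cong₂ _⊕_ (vertexParity-zeros A) (∈-parityClass⁻ u∈))

  ∈E⁺ : ∀ (xa : Vec Bool A) xb → hamming xa zeros ≡ 0 → vertexParity (xa ++ᵛ xb) ≡ 0ℙ → xa ++ᵛ xb ∈ E
  ∈E⁺ xa xb xa≡zeros even with refl ← hamming≡0⇒≡ xa zeros xa≡zeros =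
    ∈-map⁺ (zeros ++ᵛ_)
      (∈-parityClass⁺ xb (trans (sym (vertexParity-++-even zeros xb even)) (vertexParity-zeros A)))

  antipodal-weights : ∀ (xa ya : Vec Bool A) (xb yb : Vec Bool B) → hamming (xa ++ᵛ xb) (ya ++ᵛ yb) ≡ N →
    ∀ {r t} → hamming xa zeros ≡ suc r → hamming ya zeros ≡ suc t → r + t ≡ B
  antipodal-weights xa ya xb yb antipodal {r} {t} r≡ t≡ = suc-injective (suc-injective (begin
    suc (suc (r + t))                      ≡⟨ cong suc (+-suc r t) ⟨
    suc r + suc t                          ≡⟨ cong₂ _+_ r≡ t≡ ⟨
    hamming xa zeros + hamming ya zeros
      ≡⟨ hamming-antipodal xa ya (proj₁ (hamming-++-antipodal xa ya xb yb antipodal)) zeros ⟩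
    A                                      ∎))
    where open ≡-Reasoning

  antipodal-equalized-by-E : ∀ (xa ya : Vec Bool A) (xb yb : Vec Bool B) →
    vertexParity (xa ++ᵛ xb) ≡ 0ℙ → vertexParity (ya ++ᵛ yb) ≡ 0ℙ → hamming (xa ++ᵛ xb) (ya ++ᵛ yb) ≡ N →
    xa ++ᵛ xb ∈ E ⊎ ya ++ᵛ yb ∈ E ⊎ ∃ λ w → w ∈ E × hamming (xa ++ᵛ xb) w ≡ hamming (ya ++ᵛ yb) w
  antipodal-equalized-by-E xa ya xb yb x-even y-even antipodal
    with hamming xa zeros in r≡ | hamming ya zeros in t≡
  ... | zero  | _     = inj₁ (∈E⁺ xa xb r≡ x-even)
  ... | suc r | zero  = inj₂ (inj₁ (∈E⁺ ya yb t≡ y-even))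
  ... | suc r | suc t = inj₂ (inj₂ (zeros ++ᵛ u , ∈-map⁺ (zeros ++ᵛ_) (∈-parityClass⁺ u u-even) , xw≡yw))
    where
    open ≡-Reasoning
    r+t≡B : r + t ≡ B
    r+t≡B = antipodal-weights xa ya xb yb antipodal r≡ t≡
    midpoint : ∃ λ u → hamming xb u ≡ t × hamming yb u ≡ r
    midpoint = between xb yb t r
      (trans (+-comm t r) (trans r+t≡B (sym (proj₂ (hamming-++-antipodal xa ya xb yb antipodal)))))
    u : Vec Bool B
    u = proj₁ midpoint
    xb-u : hamming xb u ≡ t
    xb-u = proj₁ (proj₂ midpoint)
    yb-u : hamming yb u ≡ r
    yb-u = proj₂ (proj₂ midpoint)
    xw≡yw : hamming (xa ++ᵛ xb) (zeros ++ᵛ u) ≡ hamming (ya ++ᵛ yb) (zeros ++ᵛ u)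
    xw≡yw = begin
      hamming (xa ++ᵛ xb) (zeros ++ᵛ u)      ≡⟨ hamming-++ xa zeros xb u ⟩
      hamming xa zeros + hamming xb u        ≡⟨ cong₂ _+_ r≡ xb-u ⟩
      suc (r + t)                            ≡⟨ cong suc (+-comm r t) ⟩
      suc (t + r)                            ≡⟨ cong₂ _+_ t≡ yb-u ⟨
      hamming ya zeros + hamming yb u        ≡⟨ hamming-++ ya zeros yb u ⟨
      hamming (ya ++ᵛ yb) (zeros ++ᵛ u)      ∎
    u-even : vertexParity u ≡ 0ℙ
    u-even = begin
      vertexParity u                           ≡⟨ vertexParity-hamming xb u ⟩
      vertexParity xb ⊕ parity (hamming xb u)  ≡⟨ cong₂ (λ p d → p ⊕ parity d) xb-parity xb-u ⟩
      parity (suc r) ⊕ parity t                ≡⟨ +-homo-+ (suc r) t ⟨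
      parity (suc (r + t))                     ≡⟨ cong (parity ∘ suc) r+t≡B ⟩
      parity (m + m)                           ≡⟨ +-homo-+ m m ⟩
      parity m ⊕ parity m                      ≡⟨ p+p≡0ℙ (parity m) ⟩
      0ℙ                                       ∎
      where
      xb-parity : vertexParity xb ≡ parity (suc r)
      xb-parity = trans (sym (vertexParity-++-even xa xb x-even))
                        (trans (vertexParity≡parity-weight xa) (cong parity r≡))

  D-unique : Unique D
  D-unique = ++⁺ (parityClass-unique N 1ℙ) (map⁺ (++-injectiveʳ zeros zeros) (parityClass-unique B 0ℙ))
    λ (v∈odd , v∈E) → p≢p⁻¹ 0ℙ (trans (sym (∈E⁻ v∈E)) (∈-parityClass⁻ v∈odd))

  D-equalizer : IsDistanceEqualizer (Q N) D
  D-equalizer = equalizer-from-antipodal 1ℙ D ∈-++⁺ˡ antipodal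
    where
    antipodal : ∀ x y → x ∉ D → y ∉ D → vertexParity x ≡ 0ℙ → vertexParity y ≡ 0ℙ → hamming x y ≡ N →
      ∃ λ w → w ∈ D × hamming x w ≡ hamming y w
    antipodal x y x∉D y∉D x-even y-even x-y-antipodal
      with xa , xb , refl ← splitAt A x | ya , yb , refl ← splitAt A y
      with antipodal-equalized-by-E xa ya xb yb x-even y-even x-y-antipodal
    ... | inj₁ x∈E               = contradiction (∈-++⁺ʳ (parityClass N 1ℙ) x∈E) x∉D
    ... | inj₂ (inj₁ y∈E)        = contradiction (∈-++⁺ʳ (parityClass N 1ℙ) y∈E) y∉D
    ... | inj₂ (inj₂ (w , w∈E , xw≡yw)) = w , ∈-++⁺ʳ (parityClass N 1ℙ) w∈E , xw≡yw

  length-D : length D ≡ 2 ^ (N ∸ 1) + 2 ^ (m + m)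
  length-D = trans (length-++ (parityClass N 1ℙ))
    (cong₂ _+_ (length-parityClass (N ∸ 1) 1ℙ)
               (trans (length-map (zeros ++ᵛ_) (parityClass B 0ℙ)) (length-parityClass (m + m) 0ℙ)))

  [1+m]*4≡N : suc m * 4 ≡ N
  [1+m]*4≡N = identity m
    where
    identity : ∀ m → suc m * 4 ≡ suc (suc (suc (m + m))) + suc (m + m)
    identity = solve-∀

  N/2∸2≡m+m : N / 2 ∸ 2 ≡ m + m
  N/2∸2≡m+m = cong (_∸ 2) (trans (cong (_/ 2) (identity m)) (m*n/n≡m (suc (suc (m + m))) 2))
    where
    identity : ∀ m → suc (suc (suc (m + m))) + suc (m + m) ≡ suc (suc (m + m)) * 2
    identity = solve-∀

  upperBound : ∃ λ D → Unique D × IsDistanceEqualizer (Q N) D × length D ≤ 2 ^ (N ∸ 1) + 2 ^ (N / 2 ∸ 2)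
  upperBound = D , D-unique , D-equalizer
             , ≤-reflexive (trans length-D (cong (λ e → 2 ^ (N ∸ 1) + 2 ^ e) (sym N/2∸2≡m+m)))

multiple-of-four : ∀ n → 2 ≤ n → n % 4 ≡ 0 → ∃ λ m → n ≡ MultipleOfFour.N m
multiple-of-four n 2≤n n%4≡0 with n / 4 | m≡m%n+[m/n]*n n 4
... | zero  | n≡ = contradiction (subst (2 ≤_) (trans n≡ (cong (_+ 0) n%4≡0)) 2≤n) λ ()
... | suc m | n≡ = m , trans n≡ (trans (cong (_+ suc m * 4) n%4≡0) (MultipleOfFour.[1+m]*4≡N m))

upperBound-divisible-by-4 : ∀ n → 2 ≤ n → n % 4 ≡ 0 →
  ∃ λ D → Unique D × IsDistanceEqualizer (Q n) D × length D ≤ 2 ^ (n ∸ 1) + 2 ^ (n / 2 ∸ 2)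
upperBound-divisible-by-4 n 2≤n n%4≡0 with m , refl ← multiple-of-four n 2≤n n%4≡0 = MultipleOfFour.upperBound m

mainTheorem2 : (n : ℕ) → 2 ≤ n →
    ((n % 4 ≢ 0) → EquidistantDimension (Q n) (2 ^ (n ∸ 1)))
    × ((n % 4 ≡ 0) →
        (∀ D → Unique D → IsDistanceEqualizer (Q n) D → 2 ^ (n ∸ 1) ≤ length D)
        × (∃ λ D → Unique D × IsDistanceEqualizer (Q n) D
                   × length D ≤ 2 ^ (n ∸ 1) + 2 ^ ((n / 2) ∸ 2)))
mainTheorem2 n@(suc k) 2≤n =
  (λ n%4≢0 → ( parityClass n 1ℙ , parityClass-unique n 1ℙ , parityClass-equalizer n 1ℙ n%4≢0
             , length-parityClass k 1ℙ)
           , λ D _ → equalizer-lowerBound k D) ,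
  (λ n%4≡0 → (λ D _ → equalizer-lowerBound k D) , upperBound-divisible-by-4 n 2≤n n%4≡0)
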